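{- For any prime $p$, any positive integer $\alpha$ and any integer $k\geq 3$, the number $p^{\alpha}$ is not a $k$-layered number.
   Context: For a positive integer $k$, a positive integer $n$ is $k$-layered if the set of its positive divisors can be partitioned into $k$ disjoint subsets all having the same sum. -}

module Defs where

open import Data.Nat using (ℕ; zero; suc; _+_)
open import Data.Nat.Divisibility using (_∣_; _∣?_)
open import Data.Fin using (Fin; _≟_)
open import Data.List using (List; filter; upTo; map)
open import Data.Nat.ListAction using (sum)
open import Data.Product using (Σ; _×_)
open import Relation.Binary.PropositionalEquality using (_≡_)
open import Relation.Nullary using (Dec; yes; no)

-- The positive divisors of n, listed as the d ∈ {1, …, n} with d ∣ n
-- (upTo n = [0, …, n-1], so we map suc over it).
divisors : ℕ → List ℕ
divisors n = filter (λ d → d ∣? n) (map suc (upTo n))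

classSum : ∀ {k} → ℕ → (ℕ → Fin k) → Fin k → ℕ
classSum n c i = sum (filter (λ d → c d ≟ i) (divisors n))

-- A partition into k (labelled) parts
-- is given by an assignment c of each divisor to one of k classes (values of
-- c on non-divisors are irrelevant).
Layered : ℕ → ℕ → Set
Layered k n = Σ (ℕ → Fin k) λ c → ∀ (i j : Fin k) → classSum n c i ≡ classSum n c j

module Submission where

-- The argument only uses that a prime power n = p ^ α is *deficient*, i.e.
-- the sum σ(n) of its divisors is smaller than 2n.  If the divisors of a
-- deficient n were split into k ≥ 2 classes of a common sum s, then the class
-- containing n itself shows s ≥ n, and two distinct classes together give
-- 2n ≤ 2s ≤ σ(n) < 2n, which is absurd.

open import Defs
open import Data.Nat using (ℕ; _^_; _≤_)
open import Data.Nat.Primality using (Prime)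
open import Relation.Nullary using (¬_)

open import Data.Nat using (zero; suc; _+_; _*_; _<_; NonZero; s≤s; s≤s⁻¹)
open import Data.Nat.Properties hiding (_≟_)
open import Data.Nat.Divisibility
open import Data.Nat.Coprimality using (Coprime; coprime-divisor)
open import Data.Nat.Primality using (prime⇒irreducible; prime⇒nonZero; prime⇒nonTrivial)
open import Data.Nat.Base using (nonTrivial⇒n>1)
open import Data.Nat.ListAction using (sum)
open import Data.Nat.ListAction.Properties using (sum-++)
open import Data.List using ([]; _∷_; filter; upTo; map; _++_; [_])
open import Data.List.Properties using (filter-++; map-++; upTo-∷ʳ; filter-accept; filter-reject)
open import Data.List.Membership.Propositional using (_∈_)
open import Data.List.Membership.Propositional.Properties using (∈-filter⁺; ∈-map⁺; ∈-upTo⁺)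
open import Data.List.Relation.Unary.Any using (here; there)
open import Data.Fin using (_≟_)
import Data.Fin as Fin
open import Data.Product using (_×_; _,_; proj₁; proj₂)
open import Data.Sum using (_⊎_; inj₁; inj₂)
open import Relation.Nullary using (yes; no; contradiction)
open import Relation.Unary using (Pred; Decidable)
open import Level using (0ℓ)
open import Relation.Binary.PropositionalEquality hiding ([_])

rangeSum : {P : Pred ℕ 0ℓ} → Decidable P → ℕ → ℕ
rangeSum P? N = sum (filter P? (map suc (upTo N)))

rangeSum-suc : {P : Pred ℕ 0ℓ} (P? : Decidable P) (N : ℕ) →
               rangeSum P? (suc N) ≡ rangeSum P? N + sum (filter P? [ suc N ])
rangeSum-suc P? N = begin
  sum (filter P? (map suc (upTo (suc N))))
    ≡⟨ cong (λ l → sum (filter P? (map suc l))) (sym (upTo-∷ʳ N)) ⟩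
  sum (filter P? (map suc (upTo N ++ [ N ])))
    ≡⟨ cong (λ l → sum (filter P? l)) (map-++ suc (upTo N) [ N ]) ⟩
  sum (filter P? (map suc (upTo N) ++ [ suc N ]))
    ≡⟨ cong sum (filter-++ P? (map suc (upTo N)) [ suc N ]) ⟩
  sum (filter P? (map suc (upTo N)) ++ filter P? [ suc N ])
    ≡⟨ sum-++ (filter P? (map suc (upTo N))) (filter P? [ suc N ]) ⟩
  rangeSum P? N + sum (filter P? [ suc N ]) ∎
  where open ≡-Reasoning

rangeSum-accept : {P : Pred ℕ 0ℓ} (P? : Decidable P) (N : ℕ) →
                  P (suc N) → rangeSum P? (suc N) ≡ rangeSum P? N + suc N
rangeSum-accept P? N p = begin
  rangeSum P? (suc N)                       ≡⟨ rangeSum-suc P? N ⟩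
  rangeSum P? N + sum (filter P? [ suc N ]) ≡⟨ cong (λ l → rangeSum P? N + sum l) (filter-accept P? {xs = []} p) ⟩
  rangeSum P? N + (suc N + 0)               ≡⟨ cong (rangeSum P? N +_) (+-identityʳ (suc N)) ⟩
  rangeSum P? N + suc N                     ∎
  where open ≡-Reasoning

rangeSum-reject : {P : Pred ℕ 0ℓ} (P? : Decidable P) (N : ℕ) →
                  ¬ P (suc N) → rangeSum P? (suc N) ≡ rangeSum P? N
rangeSum-reject P? N ¬p = begin
  rangeSum P? (suc N)                       ≡⟨ rangeSum-suc P? N ⟩
  rangeSum P? N + sum (filter P? [ suc N ]) ≡⟨ cong (λ l → rangeSum P? N + sum l) (filter-reject P? {xs = []} ¬p) ⟩
  rangeSum P? N + 0                         ≡⟨ +-identityʳ (rangeSum P? N) ⟩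
  rangeSum P? N                             ∎
  where open ≡-Reasoning

rangeSum-cong : {P Q : Pred ℕ 0ℓ} (P? : Decidable P) (Q? : Decidable Q) (N : ℕ) →
                (∀ d → d ≤ N → (P d → Q d) × (Q d → P d)) →
                rangeSum P? N ≡ rangeSum Q? N
rangeSum-cong P? Q? zero agree = refl
rangeSum-cong P? Q? (suc N) agree with P? (suc N)
... | yes p = begin
  rangeSum P? (suc N)   ≡⟨ rangeSum-accept P? N p ⟩
  rangeSum P? N + suc N ≡⟨ cong (_+ suc N) (rangeSum-cong P? Q? N (λ d d≤N → agree d (m≤n⇒m≤1+n d≤N))) ⟩
  rangeSum Q? N + suc N ≡⟨ rangeSum-accept Q? N (proj₁ (agree (suc N) ≤-refl) p) ⟨
  rangeSum Q? (suc N)   ∎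
  where open ≡-Reasoning
... | no ¬p = begin
  rangeSum P? (suc N) ≡⟨ rangeSum-reject P? N ¬p ⟩
  rangeSum P? N       ≡⟨ rangeSum-cong P? Q? N (λ d d≤N → agree d (m≤n⇒m≤1+n d≤N)) ⟩
  rangeSum Q? N       ≡⟨ rangeSum-reject Q? N (λ q → ¬p (proj₂ (agree (suc N) ≤-refl) q)) ⟨
  rangeSum Q? (suc N) ∎
  where open ≡-Reasoning

rangeSum-beyond : {P : Pred ℕ 0ℓ} (P? : Decidable P) {M : ℕ} (N : ℕ) →
                  (∀ d → P d → d ≤ M) → M ≤ N → rangeSum P? N ≡ rangeSum P? M
rangeSum-beyond P? N bounded M≤N with m≤n⇒m<n∨m≡n M≤N
... | inj₂ refl = refl
rangeSum-beyond P? (suc N) bounded M≤N | inj₁ M<1+N =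
  trans (rangeSum-reject P? N (λ p → <⇒≱ M<1+N (bounded (suc N) p)))
        (rangeSum-beyond P? N bounded (s≤s⁻¹ M<1+N))

-- σ n is the sum of the positive divisors of n; it is the range sum of the
-- predicate (_∣ n) up to n.
σ : ℕ → ℕ
σ n = sum (divisors n)

σ-extend : ∀ n m .{{_ : NonZero m}} → m < n →
           (∀ d → d < n → d ∣ n → d ∣ m) → (∀ d → d ∣ m → d ∣ n) →
           σ n ≡ σ m + n
σ-extend (suc N) m m<n proper⇒∣m ∣m⇒∣n = begin
  rangeSum (_∣? suc N) (suc N) ≡⟨ rangeSum-accept (_∣? suc N) N ∣-refl ⟩
  rangeSum (_∣? suc N) N + suc N ≡⟨ cong (_+ suc N) (rangeSum-cong (_∣? suc N) (_∣? m) N agree) ⟩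
  rangeSum (_∣? m) N + suc N     ≡⟨ cong (_+ suc N) (rangeSum-beyond (_∣? m) N (λ d → ∣⇒≤) (s≤s⁻¹ m<n)) ⟩
  rangeSum (_∣? m) m + suc N     ∎
  where
  open ≡-Reasoning
  agree : ∀ d → d ≤ N → (d ∣ suc N → d ∣ m) × (d ∣ m → d ∣ suc N)
  agree d d≤N = proper⇒∣m d (s≤s d≤N) , ∣m⇒∣n d

module _ {p : ℕ} (p-prime : Prime p) where
  instance
    p≢0 : NonZero p
    p≢0 = prime⇒nonZero p-prime

  -- Every divisor of p^(a+1) is either p^(a+1) itself or a divisor of p^a:
  -- a divisor coprime to p divides p^a outright, and otherwise it is d'·p
  -- with d' a divisor of p^a, to which induction applies.
  divisor-of-prime-power : ∀ a d → d ∣ p ^ suc a → d ∣ p ^ a ⊎ d ≡ p ^ suc a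
  divisor-of-prime-power a d d∣ with p ∣? d
  ... | no p∤d = inj₁ (coprime-divisor d⊥p d∣)
    where
    d⊥p : Coprime d p
    d⊥p (e∣d , e∣p) with prime⇒irreducible p-prime e∣p
    ... | inj₁ e≡1 = e≡1
    ... | inj₂ refl = contradiction e∣d p∤d
  divisor-of-prime-power a .(d' * p) d∣ | yes (divides d' refl) = lift a d'∣
    where
    d'∣ : d' ∣ p ^ a
    d'∣ = *-cancelʳ-∣ p (subst (d' * p ∣_) (*-comm p (p ^ a)) d∣)
    lift : ∀ a → d' ∣ p ^ a → d' * p ∣ p ^ a ⊎ d' * p ≡ p ^ suc a
    lift zero d'∣1 = inj₂ (trans (cong (_* p) (∣1⇒≡1 d'∣1)) (*-comm 1 p))
    lift (suc b) d'∣pˢᵇ with divisor-of-prime-power b d' d'∣pˢᵇ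
    ... | inj₁ d'∣pᵇ = inj₁ (subst (d' * p ∣_) (*-comm (p ^ b) p) (*-monoˡ-∣ p d'∣pᵇ))
    ... | inj₂ d'≡ = inj₂ (trans (cong (_* p) d'≡) (*-comm (p ^ suc b) p))

  p^a<p^[1+a] : ∀ a → p ^ a < p ^ suc a
  p^a<p^[1+a] a = subst (p ^ a <_) (*-comm (p ^ a) p)
    (m<m*n (p ^ a) p {{m^n≢0 p a}} (nonTrivial⇒n>1 p {{prime⇒nonTrivial p-prime}}))

  -- By divisor-of-prime-power, the proper divisors of p^(a+1) are those of p^a.
  σ-prime-power-step : ∀ a → σ (p ^ suc a) ≡ σ (p ^ a) + p ^ suc a
  σ-prime-power-step a = σ-extend (p ^ suc a) (p ^ a) {{m^n≢0 p a}} (p^a<p^[1+a] a) proper⇒∣ ∣⇒∣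
    where
    proper⇒∣ : ∀ d → d < p ^ suc a → d ∣ p ^ suc a → d ∣ p ^ a
    proper⇒∣ d d< d∣ with divisor-of-prime-power a d d∣
    ... | inj₁ d∣pᵃ = d∣pᵃ
    ... | inj₂ refl = contradiction d< (<-irrefl refl)
    ∣⇒∣ : ∀ d → d ∣ p ^ a → d ∣ p ^ suc a
    ∣⇒∣ d d∣ = ∣-trans d∣ (n∣m*n p)

  -- σ(p^a) < 2·p^a: each step adds p^(a+1) to σ while 2·p^a ≤ p^(a+1).
  σ-prime-power-deficient : ∀ a → σ (p ^ a) < p ^ a + p ^ a
  σ-prime-power-deficient zero = ≤-refl
  σ-prime-power-deficient (suc a) = begin-strict
    σ (p ^ suc a)                 ≡⟨ σ-prime-power-step a ⟩
    σ (p ^ a) + p ^ suc a         <⟨ +-monoˡ-< (p ^ suc a) (σ-prime-power-deficient a) ⟩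
    (p ^ a + p ^ a) + p ^ suc a   ≤⟨ +-monoˡ-≤ (p ^ suc a) twice≤ ⟩
    p ^ suc a + p ^ suc a         ∎
    where
    open ≤-Reasoning
    twice≤ : p ^ a + p ^ a ≤ p * p ^ a
    twice≤ = subst (_≤ p * p ^ a) (cong (p ^ a +_) (+-identityʳ (p ^ a)))
               (*-monoˡ-≤ (p ^ a) (nonTrivial⇒n>1 p {{prime⇒nonTrivial p-prime}}))

sum-filter-disjoint : {P Q : Pred ℕ 0ℓ} (P? : Decidable P) (Q? : Decidable Q) →
                      (∀ x → P x → ¬ Q x) → ∀ xs →
                      sum (filter P? xs) + sum (filter Q? xs) ≤ sum xs
sum-filter-disjoint P? Q? disjoint [] = ≤-refl
sum-filter-disjoint P? Q? disjoint (x ∷ xs)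
  with ih ← sum-filter-disjoint P? Q? disjoint xs | P? x | Q? x
... | yes p | yes q = contradiction q (disjoint x p)
... | yes _ | no _ = subst (_≤ x + sum xs) (sym (+-assoc x _ _)) (+-monoʳ-≤ x ih)
... | no _ | yes _ = subst (_≤ x + sum xs) (x∙yz≈y∙xz x (sum (filter P? xs)) (sum (filter Q? xs))) (+-monoʳ-≤ x ih)
  where open import Algebra.Properties.CommutativeSemigroup +-commutativeSemigroup using (x∙yz≈y∙xz)
... | no _ | no _ = ≤-trans ih (m≤n+m (sum xs) x)

∈⇒≤sum : ∀ {x xs} → x ∈ xs → x ≤ sum xs
∈⇒≤sum {xs = y ∷ ys} (here refl) = m≤m+n y (sum ys)
∈⇒≤sum {xs = y ∷ ys} (there x∈) = ≤-trans (∈⇒≤sum x∈) (m≤n+m (sum ys) y)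

n∈divisors : ∀ n .{{_ : NonZero n}} → n ∈ divisors n
n∈divisors (suc n) = ∈-filter⁺ (_∣? suc n) (∈-map⁺ suc (∈-upTo⁺ ≤-refl)) ∣-refl

Deficient : ℕ → Set
Deficient n = σ n < n + n

-- The class of n has sum at least n, so all k classes do; two of them
-- already exceed σ n.
deficient⇒¬layered : ∀ {k n} .{{_ : NonZero n}} → 2 ≤ k → Deficient n → ¬ Layered k n
deficient⇒¬layered {suc zero} (s≤s ())
deficient⇒¬layered {suc (suc k)} {n} _ deficient (c , equal) =
  <⇒≱ deficient (begin
    n + n                                                     ≤⟨ +-mono-≤ (n≤class Fin.zero) (n≤class (Fin.suc Fin.zero)) ⟩
    classSum n c Fin.zero + classSum n c (Fin.suc Fin.zero)   ≤⟨ sum-filter-disjoint (λ d → c d ≟ Fin.zero) (λ d → c d ≟ Fin.suc Fin.zero) disjoint (divisors n) ⟩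
    σ n                                                       ∎)
  where
  open ≤-Reasoning
  n≤class : ∀ i → n ≤ classSum n c i
  n≤class i = subst (n ≤_) (equal (c n) i)
    (∈⇒≤sum (∈-filter⁺ (λ d → c d ≟ c n) (n∈divisors n) refl))
  disjoint : ∀ d → c d ≡ Fin.zero → ¬ c d ≡ Fin.suc Fin.zero
  disjoint d eq₀ eq₁ with () ← trans (sym eq₀) eq₁

mainTheorem5 : ∀ (p α k : ℕ) → Prime p → 1 ≤ α → 3 ≤ k → ¬ Layered k (p ^ α)
mainTheorem5 p α k p-prime _ 3≤k =
  deficient⇒¬layered {{m^n≢0 p α}} (≤-trans (n≤1+n 2) 3≤k) (σ-prime-power-deficient p-prime α)
  where instance _ = prime⇒nonZero p-prime
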